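{- Let $k\ge 2$ and $n\ge 1$ be integers. Then \[ \varphi_{\{e_2\}}(n)=n^k\prod_{p\mid n}\left(1-\frac{N_k(e_2,p)}{p^k}\right), \] the product running over the primes dividing $n$.
   Context: $e_2(x_1,\dots,x_k)=\sum_{1\le i<j\le k}x_ix_j$. $\varphi_{\{e_2\}}(n)$ is the number of $(a_1,\dots,a_k)\in\mathbb{Z}_n^k$ with $\gcd(e_2(a_1,\dots,a_k),n)=1$. $N_k(e_2,p)$ is the number of $(a_1,\dots,a_k)\in\mathbb{F}_p^k$ with $e_2(a_1,\dots,a_k)\equiv 0\pmod p$. -}

module Defs where

open import Data.Nat using (ℕ; zero; suc; _+_; _*_; _^_; _≟_)
open import Data.Nat.Divisibility using (_∣?_)
open import Data.Nat.GCD using (gcd)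
open import Data.Nat.Primality using (prime?)
open import Data.Fin using (Fin; toℕ; _<?_)
open import Data.Fin.Properties using ()
open import Data.Nat.ListAction using (sum)
open import Data.List using (List; []; _∷_; [_]; map; filter; length; allFin; upTo; cartesianProductWith; foldr; concatMap)
open import Data.Vec using (Vec; lookup) renaming ([] to []ᵥ; _∷_ to _∷ᵥ_)
open import Data.Integer using (+_)
open import Data.Rational using (ℚ; 0ℚ; 1ℚ; _/_) renaming (_*_ to _*ℚ_)
open import Relation.Nullary.Decidable using (_×-dec_)

tuples : (k n : ℕ) → List (Vec (Fin n) k)
tuples zero    n = [ []ᵥ ]
tuples (suc k) n = cartesianProductWith _∷ᵥ_ (allFin n) (tuples k n)

e2 : ∀ {k n} → Vec (Fin n) k → ℕ
e2 {k} a = sum (concatMap (λ i → map (λ j → toℕ (lookup a i) * toℕ (lookup a j))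
                                     (filter (λ j → i <? j) (allFin k)))
                          (allFin k))

phiE2 : (k n : ℕ) → ℕ
phiE2 k n = length (filter (λ a → gcd (e2 a) n ≟ 1) (tuples k n))

Nk : (k p : ℕ) → ℕ
Nk k p = length (filter (λ a → p ∣? e2 a) (tuples k p))

-- a / d as a rational (d ≠ 0 in all uses; d = 0 gives 0 by convention, never used).
ratio : ℕ → ℕ → ℚ
ratio a zero    = 0ℚ
ratio a (suc d) = (+ a) / suc d

primeDivisors : ℕ → List ℕ
primeDivisors n = filter (λ p → prime? p ×-dec p ∣? n) (upTo (suc n))

prodℚ : List ℚ → ℚ
prodℚ = foldr _*ℚ_ 1ℚ

{-# OPTIONS --safe #-}
module Submission where

-- Let M be the product of the primes dividing n and write n = t M. The indicator of gcd(e₂(a), n) = 1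
-- equals ∏_{p ∣ n} [p ∤ e₂(a)], which depends only on a mod M, so the count over (ℤ/n)^k is t^k times
-- the count over (ℤ/M)^k. Each factor [p ∤ e₂(a)] depends only on a mod p. By the Chinese remainder
-- theorem, summing a product of functions with coprime periods m and s over [0, m s) gives the product
-- of their sums, so the count over (ℤ/M)^k splits into ∏_p (p^k − N_k(e₂,p)).
-- Since n^k = t^k ∏_p p^k, dividing gives the formula.

module RangeSum where
  open import Data.Nat using (ℕ; zero; suc; _+_; _*_; NonZero)
  open import Data.Nat.Properties
    using (+-assoc; +-comm; +-suc; +-identityʳ; *-comm; *-zeroʳ; *-distribˡ-+; *-distribʳ-+; +-cancelˡ-≡; *-cancelˡ-≡;
           +-commutativeSemigroup)
  open import Algebra.Properties.CommutativeSemigroup +-commutativeSemigroup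
    using () renaming (interchange to +-interchange; x∙yz≈y∙xz to +-exchange)
  open import Data.Nat.Coprimality using (Coprime; coprime-Bézout)
  open import Data.Nat.GCD using (module Bézout)
  open import Function using (_∘_)
  open import Relation.Binary.PropositionalEquality
  open ≡-Reasoning

  ∑ : ℕ → (ℕ → ℕ) → ℕ
  ∑ zero    f = 0
  ∑ (suc n) f = f 0 + ∑ n (f ∘ suc)

  syntax ∑ n (λ i → e) = ∑[ i < n ] e

  ∑-cong : ∀ n {f g : ℕ → ℕ} → (∀ i → f i ≡ g i) → ∑ n f ≡ ∑ n g
  ∑-cong zero    f≗g = refl
  ∑-cong (suc n) f≗g = cong₂ _+_ (f≗g 0) (∑-cong n (f≗g ∘ suc))

  ∑-const : ∀ n c → ∑ n (λ _ → c) ≡ n * c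
  ∑-const zero    c = refl
  ∑-const (suc n) c = cong (c +_) (∑-const n c)

  ∑-distrib-+ : ∀ n f g → ∑[ i < n ] (f i + g i) ≡ ∑ n f + ∑ n g
  ∑-distrib-+ zero    f g = refl
  ∑-distrib-+ (suc n) f g =
    trans (cong (f 0 + g 0 +_) (∑-distrib-+ n (f ∘ suc) (g ∘ suc))) (+-interchange (f 0) (g 0) _ _)

  ∑-*ˡ : ∀ n c f → ∑[ i < n ] (c * f i) ≡ c * ∑ n f
  ∑-*ˡ zero    c f = sym (*-zeroʳ c)
  ∑-*ˡ (suc n) c f = trans (cong (c * f 0 +_) (∑-*ˡ n c (f ∘ suc))) (sym (*-distribˡ-+ c (f 0) _))

  ∑-*ʳ : ∀ n c f → ∑[ i < n ] (f i * c) ≡ ∑ n f * c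
  ∑-*ʳ n c f = trans (∑-cong n (λ i → *-comm (f i) c)) (trans (∑-*ˡ n c f) (*-comm c _))

  ∑-split : ∀ a b f → ∑ (a + b) f ≡ ∑ a f + ∑[ j < b ] f (a + j)
  ∑-split zero    b f = refl
  ∑-split (suc a) b f = trans (cong (f 0 +_) (∑-split a b (f ∘ suc))) (sym (+-assoc (f 0) _ _))

  ∑-last : ∀ n f → ∑ (suc n) f ≡ ∑ n f + f n
  ∑-last zero    f = +-comm (f 0) 0
  ∑-last (suc n) f = trans (cong (f 0 +_) (∑-last n (f ∘ suc))) (sym (+-assoc (f 0) _ _))

  ∑-comm : ∀ a b (f : ℕ → ℕ → ℕ) → ∑[ i < a ] ∑[ j < b ] f i j ≡ ∑[ j < b ] ∑[ i < a ] f i j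
  ∑-comm zero    b f = sym (trans (∑-const b 0) (*-zeroʳ b))
  ∑-comm (suc a) b f = trans (cong (∑ b (f 0) +_) (∑-comm a b (f ∘ suc)))
                             (sym (∑-distrib-+ b (f 0) (λ j → ∑[ i < a ] f (suc i) j)))

  ∑-blocks : ∀ b m h → ∑ (b * m) h ≡ ∑[ j < b ] ∑[ i < m ] h (j * m + i)
  ∑-blocks zero    m h = refl
  ∑-blocks (suc b) m h = trans (∑-split m (b * m) h) (cong (∑ m h +_) (trans (∑-blocks b m (λ y → h (m + y)))
    (∑-cong b (λ j → ∑-cong m (λ i → cong h (sym (+-assoc m (j * m) i)))))))

  Periodic : ℕ → (ℕ → ℕ) → Set
  Periodic m g = ∀ x → g (m + x) ≡ g x

  periodic-* : ∀ {m g} → Periodic m g → ∀ b x → g (b * m + x) ≡ g x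
  periodic-* g-per zero    x = refl
  periodic-* {m} {g} g-per (suc b) x = trans (cong g (+-assoc m (b * m) x)) (trans (g-per _) (periodic-* g-per b x))

  periodic-suc : ∀ {m g} → Periodic m g → Periodic m (g ∘ suc)
  periodic-suc {m} {g} g-per x = trans (cong g (sym (+-suc m x))) (g-per (suc x))

  ∑-rotate : ∀ m g → Periodic m g → ∑[ c < m ] g (suc c) ≡ ∑ m g
  ∑-rotate m g g-per = +-cancelˡ-≡ (g 0) _ _ (begin
    g 0 + ∑ m (g ∘ suc)  ≡⟨ ∑-last m g ⟩
    ∑ m g + g m          ≡⟨ cong (∑ m g +_) (trans (cong g (sym (+-identityʳ m))) (g-per 0)) ⟩
    ∑ m g + g 0          ≡⟨ +-comm _ (g 0) ⟩
    g 0 + ∑ m g          ∎)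

  ∑-translate : ∀ m g → Periodic m g → ∀ t → ∑[ c < m ] g (t + c) ≡ ∑ m g
  ∑-translate m g g-per zero    = refl
  ∑-translate m g g-per (suc t) =
    trans (∑-translate m (g ∘ suc) (periodic-suc g-per) t) (∑-rotate m g g-per)

  ∑-periodic : ∀ t m f → Periodic m f → ∑ (t * m) f ≡ t * ∑ m f
  ∑-periodic t m f f-per = begin
    ∑ (t * m) f                              ≡⟨ ∑-blocks t m f ⟩
    ∑[ j < t ] ∑[ i < m ] f (j * m + i)      ≡⟨ ∑-cong t (λ j → ∑-cong m (periodic-* f-per j)) ⟩
    ∑[ j < t ] ∑ m f                          ≡⟨ ∑-const t _ ⟩
    t * ∑ m f                                ∎

  periodic-coprime⇒periodic-1 : ∀ {m s H} → Coprime m s → Periodic m H → Periodic s H → Periodic 1 H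
  periodic-coprime⇒periodic-1 {m} {s} {H} co m-per s-per c with coprime-Bézout co
  ... | Bézout.+- x y eq = begin
    H (suc c)          ≡⟨ periodic-* s-per y (suc c) ⟨
    H (y * s + suc c)  ≡⟨ cong H (trans (+-suc (y * s) c) (cong (_+ c) eq)) ⟩
    H (x * m + c)      ≡⟨ periodic-* m-per x c ⟩
    H c                ∎
  ... | Bézout.-+ x y eq = begin
    H (suc c)          ≡⟨ periodic-* m-per x (suc c) ⟨
    H (x * m + suc c)  ≡⟨ cong H (trans (+-suc (x * m) c) (cong (_+ c) eq)) ⟩
    H (y * s + c)      ≡⟨ periodic-* s-per y c ⟩
    H c                ∎

  periodic-1⇒constant : ∀ {H} → Periodic 1 H → ∀ c → H c ≡ H 0
  periodic-1⇒constant H-per zero    = refl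
  periodic-1⇒constant H-per (suc c) = trans (H-per c) (periodic-1⇒constant H-per c)

  stride-periodic : ∀ {m s g} → Periodic s g → ∀ c → Periodic s (λ j → g (j * m + c))
  stride-periodic {m} {s} {g} g-per c j = begin
    g ((s + j) * m + c)      ≡⟨ cong (λ z → g (z + c)) (*-distribʳ-+ m s j) ⟩
    g (s * m + j * m + c)    ≡⟨ cong g (+-assoc (s * m) (j * m) c) ⟩
    g (s * m + (j * m + c))  ≡⟨ cong (λ z → g (z + (j * m + c))) (*-comm s m) ⟩
    g (m * s + (j * m + c))  ≡⟨ periodic-* g-per m (j * m + c) ⟩
    g (j * m + c)            ∎

  -- As a function of c the left-hand side is m-periodic (by rotation) and s-periodic, hence constant
  -- by Bézout; averaging over c < s identifies the constant with ∑ s g.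
  ∑-coprime-stride : ∀ m s .{{_ : NonZero s}} g → Coprime m s → Periodic s g → ∀ c → ∑[ j < s ] g (j * m + c) ≡ ∑ s g
  ∑-coprime-stride m s g co g-per c = trans (H-constant c) (*-cancelˡ-≡ _ _ s (begin
    s * H 0                               ≡⟨ ∑-const s (H 0) ⟨
    ∑[ c < s ] H 0                        ≡⟨ ∑-cong s H-constant ⟨
    ∑[ c < s ] ∑[ j < s ] g (j * m + c)   ≡⟨ ∑-comm s s (λ c j → g (j * m + c)) ⟩
    ∑[ j < s ] ∑[ c < s ] g (j * m + c)   ≡⟨ ∑-cong s (λ j → ∑-translate s g g-per (j * m)) ⟩
    ∑[ j < s ] ∑ s g                      ≡⟨ ∑-const s _ ⟩
    s * ∑ s g                             ∎))
    where
    H : ℕ → ℕ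
    H x = ∑[ j < s ] g (j * m + x)

    H-periodic-m : Periodic m H
    H-periodic-m x = trans (∑-cong s (λ j → cong g (trans (sym (+-assoc (j * m) m x)) (cong (_+ x) (+-comm (j * m) m)))))
                           (∑-rotate s (λ j → g (j * m + x)) (stride-periodic g-per x))

    H-periodic-s : Periodic s H
    H-periodic-s x = ∑-cong s (λ j → trans (cong g (+-exchange (j * m) s x)) (g-per _))

    H-constant : ∀ c → H c ≡ H 0
    H-constant = periodic-1⇒constant (periodic-coprime⇒periodic-1 co H-periodic-m H-periodic-s)

  ∑-crt : ∀ m s .{{_ : NonZero s}} f g → Coprime m s → Periodic m f → Periodic s g →
          ∑[ x < m * s ] (f x * g x) ≡ ∑ m f * ∑ s g
  ∑-crt m s f g co f-per g-per = begin
    ∑[ x < m * s ] (f x * g x)                             ≡⟨ cong (λ z → ∑[ x < z ] (f x * g x)) (*-comm m s) ⟩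
    ∑[ x < s * m ] (f x * g x)                             ≡⟨ ∑-blocks s m _ ⟩
    ∑[ j < s ] ∑[ i < m ] (f (j * m + i) * g (j * m + i))
      ≡⟨ ∑-cong s (λ j → ∑-cong m (λ i → cong (_* g (j * m + i)) (periodic-* f-per j i))) ⟩
    ∑[ j < s ] ∑[ i < m ] (f i * g (j * m + i))            ≡⟨ ∑-comm s m _ ⟩
    ∑[ i < m ] ∑[ j < s ] (f i * g (j * m + i))            ≡⟨ ∑-cong m (λ i → ∑-*ˡ s (f i) _) ⟩
    ∑[ i < m ] (f i * ∑[ j < s ] g (j * m + i))
      ≡⟨ ∑-cong m (λ i → cong (f i *_) (∑-coprime-stride m s g co g-per i)) ⟩
    ∑[ i < m ] (f i * ∑ s g)                               ≡⟨ ∑-*ʳ m _ f ⟩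
    ∑ m f * ∑ s g                                          ∎

module Congruence where
  open import Data.Nat using (ℕ; _+_; _*_; _%_; NonZero)
  open import Data.Nat.DivMod using (%-distribˡ-+; %-distribˡ-*; m∣n⇒o%n%m≡o%m)
  open import Data.Nat.Divisibility using (_∣_; m%n≡0⇒n∣m; n∣m⇒m%n≡0)
  open import Data.Nat.ListAction using (sum)
  open import Data.List using ([]; _∷_; map)
  open import Relation.Binary.PropositionalEquality

  infix 4 _≡_[mod_]

  _≡_[mod_] : ℕ → ℕ → (m : ℕ) .{{_ : NonZero m}} → Set
  x ≡ y [mod m ] = x % m ≡ y % m

  module _ (m : ℕ) .{{_ : NonZero m}} where

    +-cong-mod : ∀ {a a′ b b′} → a ≡ a′ [mod m ] → b ≡ b′ [mod m ] → a + b ≡ a′ + b′ [mod m ]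
    +-cong-mod {a} {a′} {b} {b′} a≡a′ b≡b′ =
      trans (%-distribˡ-+ a b m) (trans (cong₂ (λ x y → (x + y) % m) a≡a′ b≡b′) (sym (%-distribˡ-+ a′ b′ m)))

    *-cong-mod : ∀ {a a′ b b′} → a ≡ a′ [mod m ] → b ≡ b′ [mod m ] → a * b ≡ a′ * b′ [mod m ]
    *-cong-mod {a} {a′} {b} {b′} a≡a′ b≡b′ =
      trans (%-distribˡ-* a b m) (trans (cong₂ (λ x y → (x * y) % m) a≡a′ b≡b′) (sym (%-distribˡ-* a′ b′ m)))

    sum-map-cong-mod : ∀ {a} {A : Set a} {f g : A → ℕ} → (∀ x → f x ≡ g x [mod m ]) →
                       ∀ xs → sum (map f xs) ≡ sum (map g xs) [mod m ]
    sum-map-cong-mod f≡g []       = refl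
    sum-map-cong-mod f≡g (x ∷ xs) = +-cong-mod (f≡g x) (sum-map-cong-mod f≡g xs)

    ∣-resp-mod : ∀ {x y} → x ≡ y [mod m ] → m ∣ x → m ∣ y
    ∣-resp-mod {x} {y} x≡y m∣x = m%n≡0⇒n∣m y m (trans (sym x≡y) (n∣m⇒m%n≡0 x m m∣x))

  ≡-mod-divisor : ∀ {d m x y} .{{_ : NonZero d}} .{{_ : NonZero m}} → d ∣ m → x ≡ y [mod m ] → x ≡ y [mod d ]
  ≡-mod-divisor {d} {m} {x} {y} d∣m x≡y =
    trans (sym (m∣n⇒o%n%m≡o%m d m x d∣m)) (trans (cong (_% d) x≡y) (m∣n⇒o%n%m≡o%m d m y d∣m))

module BoxSum where
  open import Data.Nat using (ℕ; zero; suc; _+_; _*_; _^_; NonZero)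
  open import Data.Nat.Properties using (+-identityʳ; *-commutativeSemigroup)
  open import Algebra.Properties.CommutativeSemigroup *-commutativeSemigroup using () renaming (x∙yz≈yx∙z to *-exchange)
  open import Data.Nat.Coprimality using (Coprime)
  open import Data.Nat.DivMod using (%-remove-+ˡ)
  open import Data.Nat.Divisibility using (∣-refl)
  open import Data.Vec using (Vec; []; _∷_)
  open import Data.Vec.Relation.Binary.Pointwise.Inductive as Pointwise using (Pointwise; _∷_)
  open import Relation.Binary.PropositionalEquality
  open ≡-Reasoning
  open RangeSum
  open Congruence

  infix 4 _≡ᵛ_[mod_]

  _≡ᵛ_[mod_] : ∀ {k} → Vec ℕ k → Vec ℕ k → (m : ℕ) .{{_ : NonZero m}} → Set
  u ≡ᵛ v [mod m ] = Pointwise (λ x y → x ≡ y [mod m ]) u v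

  Periodicᵛ : ∀ {k} (m : ℕ) .{{_ : NonZero m}} → (Vec ℕ k → ℕ) → Set
  Periodicᵛ m f = ∀ {u v} → u ≡ᵛ v [mod m ] → f u ≡ f v

  ∑ᵛ : ∀ k → ℕ → (Vec ℕ k → ℕ) → ℕ
  ∑ᵛ zero    n f = f []
  ∑ᵛ (suc k) n f = ∑[ x < n ] ∑ᵛ k n (λ v → f (x ∷ v))

  ∑ᵛ-cong : ∀ k n {f g : Vec ℕ k → ℕ} → (∀ v → f v ≡ g v) → ∑ᵛ k n f ≡ ∑ᵛ k n g
  ∑ᵛ-cong zero    n f≗g = f≗g []
  ∑ᵛ-cong (suc k) n f≗g = ∑-cong n (λ x → ∑ᵛ-cong k n (λ v → f≗g (x ∷ v)))

  ∑ᵛ-distrib-+ : ∀ k n f g → ∑ᵛ k n (λ v → f v + g v) ≡ ∑ᵛ k n f + ∑ᵛ k n g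
  ∑ᵛ-distrib-+ zero    n f g = refl
  ∑ᵛ-distrib-+ (suc k) n f g =
    trans (∑-cong n (λ x → ∑ᵛ-distrib-+ k n (λ v → f (x ∷ v)) (λ v → g (x ∷ v)))) (∑-distrib-+ n _ _)

  ∑ᵛ-1 : ∀ k n → ∑ᵛ k n (λ _ → 1) ≡ n ^ k
  ∑ᵛ-1 zero    n = refl
  ∑ᵛ-1 (suc k) n = trans (∑-cong n (λ _ → ∑ᵛ-1 k n)) (∑-const n _)

  module _ (m : ℕ) .{{_ : NonZero m}} where

    periodicᵛ-tail : ∀ {k} {f : Vec ℕ (suc k) → ℕ} → Periodicᵛ m f → ∀ x → Periodicᵛ m (λ v → f (x ∷ v))
    periodicᵛ-tail f-per x u≡v = f-per (refl ∷ u≡v)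

    periodicᵛ-head : ∀ {k} n {f : Vec ℕ (suc k) → ℕ} → Periodicᵛ m f → Periodic m (λ x → ∑ᵛ k n (λ v → f (x ∷ v)))
    periodicᵛ-head {k} n f-per x = ∑ᵛ-cong k n (λ v → f-per (%-remove-+ˡ x ∣-refl ∷ Pointwise.refl refl))

  ∑ᵛ-periodic : ∀ k t m .{{_ : NonZero m}} f → Periodicᵛ m f → ∑ᵛ k (t * m) f ≡ t ^ k * ∑ᵛ k m f
  ∑ᵛ-periodic zero    t m f f-per = sym (+-identityʳ (f []))
  ∑ᵛ-periodic (suc k) t m f f-per = begin
    ∑[ x < t * m ] ∑ᵛ k (t * m) (λ v → f (x ∷ v))  ≡⟨ ∑-cong (t * m) (λ x → ∑ᵛ-periodic k t m _ (periodicᵛ-tail m f-per x)) ⟩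
    ∑[ x < t * m ] (t ^ k * F x)                   ≡⟨ ∑-*ˡ (t * m) (t ^ k) F ⟩
    t ^ k * ∑ (t * m) F                            ≡⟨ cong (t ^ k *_) (∑-periodic t m F (periodicᵛ-head m m f-per)) ⟩
    t ^ k * (t * ∑ m F)                            ≡⟨ *-exchange (t ^ k) t _ ⟩
    t * t ^ k * ∑ m F                              ∎
    where
    F : ℕ → ℕ
    F x = ∑ᵛ k m (λ v → f (x ∷ v))

  ∑ᵛ-crt : ∀ k m s .{{_ : NonZero m}} .{{_ : NonZero s}} f g → Coprime m s → Periodicᵛ m f → Periodicᵛ s g →
           ∑ᵛ k (m * s) (λ v → f v * g v) ≡ ∑ᵛ k m f * ∑ᵛ k s g
  ∑ᵛ-crt zero    m s f g co f-per g-per = refl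
  ∑ᵛ-crt (suc k) m s f g co f-per g-per = trans
    (∑-cong (m * s) (λ x → ∑ᵛ-crt k m s _ _ co (periodicᵛ-tail m f-per x) (periodicᵛ-tail s g-per x)))
    (∑-crt m s _ _ co (periodicᵛ-head m m f-per) (periodicᵛ-head s s g-per))

module Indicator where
  open import Data.Nat using (ℕ; suc; _+_; _*_)
  open import Data.Nat.ListAction using (sum; product)
  open import Data.List using ([]; _∷_; map; filter; length)
  open import Data.List.Relation.Unary.All using (all?; _∷_; uncons)
  open import Data.Product using (uncurry)
  open import Data.Empty using (⊥-elim)
  open import Function using (_∘_)
  open import Relation.Nullary using (Dec; yes; no; ¬?; _×-dec_)
  open import Relation.Unary using (Pred; Decidable)
  open import Relation.Binary.PropositionalEquality

  𝟙 : ∀ {p} {P : Set p} → Dec P → ℕ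
  𝟙 (yes _) = 1
  𝟙 (no _)  = 0

  𝟙-cong : ∀ {p q} {P : Set p} {Q : Set q} (P? : Dec P) (Q? : Dec Q) → (P → Q) → (Q → P) → 𝟙 P? ≡ 𝟙 Q?
  𝟙-cong (yes _) (yes _)  P⇒Q Q⇒P = refl
  𝟙-cong (yes p) (no ¬q)  P⇒Q Q⇒P = ⊥-elim (¬q (P⇒Q p))
  𝟙-cong (no ¬p) (yes q)  P⇒Q Q⇒P = ⊥-elim (¬p (Q⇒P q))
  𝟙-cong (no _)  (no _)   P⇒Q Q⇒P = refl

  𝟙-¬?+𝟙 : ∀ {p} {P : Set p} (P? : Dec P) → 𝟙 (¬? P?) + 𝟙 P? ≡ 1
  𝟙-¬?+𝟙 (yes _) = refl
  𝟙-¬?+𝟙 (no _)  = refl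

  𝟙-×-dec : ∀ {p q} {P : Set p} {Q : Set q} (P? : Dec P) (Q? : Dec Q) → 𝟙 (P? ×-dec Q?) ≡ 𝟙 P? * 𝟙 Q?
  𝟙-×-dec (yes _) (yes _) = refl
  𝟙-×-dec (yes _) (no _)  = refl
  𝟙-×-dec (no _)  _       = refl

  product-𝟙 : ∀ {a p} {A : Set a} {P : Pred A p} (P? : Decidable P) xs → product (map (𝟙 ∘ P?) xs) ≡ 𝟙 (all? P? xs)
  product-𝟙 P? []       = refl
  product-𝟙 P? (x ∷ xs) = begin
    𝟙 (P? x) * product (map (𝟙 ∘ P?) xs)  ≡⟨ cong (𝟙 (P? x) *_) (product-𝟙 P? xs) ⟩
    𝟙 (P? x) * 𝟙 (all? P? xs)             ≡⟨ 𝟙-×-dec (P? x) (all? P? xs) ⟨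
    𝟙 (P? x ×-dec all? P? xs)             ≡⟨ 𝟙-cong _ (all? P? (x ∷ xs)) (uncurry _∷_) uncons ⟩
    𝟙 (all? P? (x ∷ xs))                  ∎
    where open ≡-Reasoning

  length-filter≡sum-𝟙 : ∀ {a p} {A : Set a} {P : Pred A p} (P? : Decidable P) xs →
                        length (filter P? xs) ≡ sum (map (𝟙 ∘ P?) xs)
  length-filter≡sum-𝟙 P? []       = refl
  length-filter≡sum-𝟙 P? (x ∷ xs) with P? x
  ... | yes _ = cong suc (length-filter≡sum-𝟙 P? xs)
  ... | no  _ = length-filter≡sum-𝟙 P? xs

module Enumeration where
  open import Defs using (tuples; e2)
  open import Data.Nat using (ℕ; zero; suc; _+_; _*_; _%_; NonZero)
  open import Data.Nat.ListAction using (sum)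
  open import Data.Nat.ListAction.Properties using (sum-++)
  open import Data.Nat.Properties using (+-identityʳ)
  open import Data.List using (List; []; _∷_; _++_; map; filter; length; allFin; tabulate; concatMap; cartesianProductWith)
  open import Data.List.Properties using (map-cong; map-++; map-∘; map-tabulate; concatMap-cong)
  open import Data.Fin as Fin using (Fin; toℕ; _<?_)
  open import Data.Vec as Vec using (Vec; lookup)
  open import Data.Vec.Properties using (lookup-map)
  open import Data.Vec.Relation.Binary.Pointwise.Inductive as Pointwise using ()
  open import Function using (_∘_; id)
  open import Relation.Unary using (Pred; Decidable)
  open import Relation.Binary.PropositionalEquality
  open ≡-Reasoning
  open RangeSum
  open Congruence
  open BoxSum
  open Indicator

  sum-concatMap : ∀ {a} {A : Set a} (f : A → List ℕ) xs → sum (concatMap f xs) ≡ sum (map (sum ∘ f) xs)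
  sum-concatMap f []       = refl
  sum-concatMap f (x ∷ xs) = trans (sum-++ (f x) (concatMap f xs)) (cong (sum (f x) +_) (sum-concatMap f xs))

  sum-map-cartesianProductWith : ∀ {a b c} {A : Set a} {B : Set b} {C : Set c} (h : C → ℕ) (f : A → B → C) xs ys →
    sum (map h (cartesianProductWith f xs ys)) ≡ sum (map (λ x → sum (map (h ∘ f x) ys)) xs)
  sum-map-cartesianProductWith h f []       ys = refl
  sum-map-cartesianProductWith h f (x ∷ xs) ys = begin
    sum (map h (map (f x) ys ++ cartesianProductWith f xs ys))
      ≡⟨ cong sum (map-++ h (map (f x) ys) _) ⟩
    sum (map h (map (f x) ys) ++ map h (cartesianProductWith f xs ys))
      ≡⟨ sum-++ (map h (map (f x) ys)) _ ⟩
    sum (map h (map (f x) ys)) + sum (map h (cartesianProductWith f xs ys))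
      ≡⟨ cong₂ _+_ (cong sum (sym (map-∘ ys))) (sum-map-cartesianProductWith h f xs ys) ⟩
    sum (map (h ∘ f x) ys) + sum (map (λ x → sum (map (h ∘ f x) ys)) xs)
      ∎

  sum-map-allFin : ∀ n (F : ℕ → ℕ) → sum (map (F ∘ toℕ) (allFin n)) ≡ ∑ n F
  sum-map-allFin zero    F = refl
  sum-map-allFin (suc n) F = cong (F 0 +_) (begin
    sum (map (F ∘ toℕ) (tabulate {n = n} Fin.suc))  ≡⟨ cong sum (map-tabulate {n = n} Fin.suc (F ∘ toℕ)) ⟩
    sum (tabulate {n = n} (F ∘ suc ∘ toℕ))          ≡⟨ cong sum (map-tabulate {n = n} id (F ∘ suc ∘ toℕ)) ⟨
    sum (map (F ∘ suc ∘ toℕ) (allFin n))            ≡⟨ sum-map-allFin n (F ∘ suc) ⟩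
    ∑ n (F ∘ suc)                                   ∎)

  sum-map-tuples : ∀ k n (h : Vec ℕ k → ℕ) → sum (map (h ∘ Vec.map toℕ) (tuples k n)) ≡ ∑ᵛ k n h
  sum-map-tuples zero    n h = +-identityʳ (h Vec.[])
  sum-map-tuples (suc k) n h = begin
    sum (map (h ∘ Vec.map toℕ) (cartesianProductWith Vec._∷_ (allFin n) (tuples k n)))
      ≡⟨ sum-map-cartesianProductWith _ Vec._∷_ (allFin n) _ ⟩
    sum (map (λ x → sum (map (λ a → h (toℕ x Vec.∷ Vec.map toℕ a)) (tuples k n))) (allFin n))
      ≡⟨ cong sum (map-cong (λ x → sum-map-tuples k n (λ v → h (toℕ x Vec.∷ v))) (allFin n)) ⟩
    sum (map (λ x → ∑ᵛ k n (λ v → h (toℕ x Vec.∷ v))) (allFin n))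
      ≡⟨ sum-map-allFin n (λ x → ∑ᵛ k n (λ v → h (x Vec.∷ v))) ⟩
    ∑ᵛ (suc k) n h
      ∎

  e₂ : ∀ {k} → Vec ℕ k → ℕ
  e₂ {k} v = sum (concatMap (λ i → map (λ j → lookup v i * lookup v j) (filter (i <?_) (allFin k))) (allFin k))

  e2≡e₂ : ∀ {k n} (a : Vec (Fin n) k) → e2 a ≡ e₂ (Vec.map toℕ a)
  e2≡e₂ {k} a = cong sum (concatMap-cong (λ i → map-cong (λ j →
    cong₂ _*_ (sym (lookup-map i toℕ a)) (sym (lookup-map j toℕ a))) _) (allFin k))

  count-e2 : ∀ k n {p} {P : Pred ℕ p} (P? : Decidable P) →
             length (filter (P? ∘ e2) (tuples k n)) ≡ ∑ᵛ k n (𝟙 ∘ P? ∘ e₂)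
  count-e2 k n P? = begin
    length (filter (P? ∘ e2) (tuples k n))        ≡⟨ length-filter≡sum-𝟙 (P? ∘ e2) (tuples k n) ⟩
    sum (map (𝟙 ∘ P? ∘ e2) (tuples k n))          ≡⟨ cong sum (map-cong (cong (𝟙 ∘ P?) ∘ e2≡e₂) (tuples k n)) ⟩
    sum (map (𝟙 ∘ P? ∘ e₂ ∘ Vec.map toℕ) (tuples k n)) ≡⟨ sum-map-tuples k n (𝟙 ∘ P? ∘ e₂) ⟩
    ∑ᵛ k n (𝟙 ∘ P? ∘ e₂)                          ∎

  e₂-cong-mod : ∀ m .{{_ : NonZero m}} {k} {u v : Vec ℕ k} → u ≡ᵛ v [mod m ] → e₂ u ≡ e₂ v [mod m ]
  e₂-cong-mod m {k} {u} {v} u≡v = begin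
    e₂ u % m                                ≡⟨ cong (_% m) (sum-concatMap (row u) (allFin k)) ⟩
    sum (map (sum ∘ row u) (allFin k)) % m  ≡⟨ sum-map-cong-mod m (λ i → sum-map-cong-mod m (λ j →
                                                 *-cong-mod m (Pointwise.lookup u≡v i) (Pointwise.lookup u≡v j))
                                                 (filter (i <?_) (allFin k))) (allFin k) ⟩
    sum (map (sum ∘ row v) (allFin k)) % m  ≡⟨ cong (_% m) (sum-concatMap (row v) (allFin k)) ⟨
    e₂ v % m                                ∎
    where
    row : Vec ℕ k → Fin k → List ℕ
    row w i = map (λ j → lookup w i * lookup w j) (filter (i <?_) (allFin k))

module PrimeDivisors where
  open import Defs using (primeDivisors)
  open import Data.Nat using (ℕ; suc; _*_; _≟_; NonZero; s≤s; ≢-nonZero; ≢-nonZero⁻¹; nonTrivial⇒≢1)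
  open import Data.Nat.Properties using (*-comm)
  open import Data.Nat.Divisibility
    using (_∣_; _∤_; _∣?_; divides; 1∣_; ∣-trans; m∣m*n; ∣1⇒≡1; 0∣⇒≡0; ∣⇒≤; *-monoˡ-∣)
  open import Data.Nat.GCD using (gcd; gcd[m,n]∣m; gcd[m,n]∣n; gcd-greatest)
  open import Data.Nat.Coprimality using (Coprime; coprime-divisor)
  open import Data.Nat.Primality using (Prime; prime?; prime⇒irreducible; prime⇒nonTrivial)
  open import Data.Nat.Primality.Factorisation using (factorise; factorisationHasAllPrimeFactors)
  open import Data.Nat.ListAction using (product)
  open import Data.List using ([]; _∷_; upTo)
  open import Data.List.Membership.Propositional using (_∈_; _∉_)
  open import Data.List.Membership.Propositional.Properties using (∈-filter⁺; ∈-upTo⁺)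
  open import Data.List.Relation.Unary.All as All using (All; []; _∷_)
  open import Data.List.Relation.Unary.All.Properties using (all-filter; All¬⇒¬Any)
  open import Data.List.Relation.Unary.AllPairs using (_∷_)
  open import Data.List.Relation.Unary.Unique.Propositional using (Unique)
  open import Data.List.Relation.Unary.Unique.Propositional.Properties using (upTo⁺; filter⁺)
  open import Data.Product using (∃-syntax; _×_; _,_; proj₁; proj₂)
  open import Data.Sum using (inj₁; inj₂)
  open import Data.Empty using (⊥-elim)
  open import Relation.Nullary using (¬_; yes; no; _×-dec_)
  open import Relation.Binary.PropositionalEquality

  prime∤⇒coprime : ∀ {p m} → Prime p → p ∤ m → Coprime p m
  prime∤⇒coprime p-prime p∤m (d∣p , d∣m) with prime⇒irreducible p-prime d∣p
  ... | inj₁ d≡1    = d≡1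
  ... | inj₂ refl   = ⊥-elim (p∤m d∣m)

  prime∉⇒∤product : ∀ {p qs} → Prime p → All Prime qs → p ∉ qs → p ∤ product qs
  prime∉⇒∤product p-prime qs-prime p∉qs p∣Πqs = p∉qs (factorisationHasAllPrimeFactors p-prime p∣Πqs qs-prime)

  product-∣ : ∀ {n} ps → All Prime ps → Unique ps → All (_∣ n) ps → product ps ∣ n
  product-∣ {n} []   _                  _              _               = 1∣ n
  product-∣ (p ∷ ps) (p-prime ∷ ps-prime) (p∉ps ∷ ps-unique) (p∣n ∷ ps∣n)
    with product-∣ ps ps-prime ps-unique ps∣n
  ... | divides t n≡tΠps = subst (p * product ps ∣_) (sym n≡tΠps) (*-monoˡ-∣ (product ps) p∣t)
    where
    p∣t : p ∣ t
    p∣t = coprime-divisor (prime∤⇒coprime p-prime (prime∉⇒∤product p-prime ps-prime (All¬⇒¬Any p∉ps)))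
                          (subst (p ∣_) (trans n≡tΠps (*-comm t (product ps))) p∣n)

  prime-divisor : ∀ g .{{_ : NonZero g}} → g ≢ 1 → ∃[ q ] Prime q × q ∣ g
  prime-divisor g g≢1 with factorise g
  ... | record { factors = [] ; isFactorisation = g≡1 } = ⊥-elim (g≢1 g≡1)
  ... | record { factors = q ∷ qs ; isFactorisation = g≡Πqs ; factorsPrime = q-prime ∷ _ } =
    q , q-prime , subst (q ∣_) (sym g≡Πqs) (m∣m*n (product qs))

  module _ (n : ℕ) where

    primeDivisors-prime-∣ : All (λ p → Prime p × p ∣ n) (primeDivisors n)
    primeDivisors-prime-∣ = all-filter (λ p → prime? p ×-dec p ∣? n) (upTo (suc n))

    primeDivisors-unique : Unique (primeDivisors n)
    primeDivisors-unique = filter⁺ (λ p → prime? p ×-dec p ∣? n) (upTo⁺ (suc n))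

    product-primeDivisors-∣ : product (primeDivisors n) ∣ n
    product-primeDivisors-∣ = product-∣ (primeDivisors n) (All.map proj₁ primeDivisors-prime-∣) primeDivisors-unique
                                        (All.map proj₂ primeDivisors-prime-∣)

    ∈-primeDivisors : .{{_ : NonZero n}} → ∀ {p} → Prime p → p ∣ n → p ∈ primeDivisors n
    ∈-primeDivisors p-prime p∣n = ∈-filter⁺ (λ p → prime? p ×-dec p ∣? n) (∈-upTo⁺ (s≤s (∣⇒≤ p∣n))) (p-prime , p∣n)

    gcd≡1⇒primeDivisors-∤ : ∀ {x} → gcd x n ≡ 1 → All (_∤ x) (primeDivisors n)
    gcd≡1⇒primeDivisors-∤ {x} gcd≡1 = All.map (λ { (p-prime , p∣n) p∣x →
      nonTrivial⇒≢1 {{prime⇒nonTrivial p-prime}} (∣1⇒≡1 (subst (_ ∣_) gcd≡1 (gcd-greatest p∣x p∣n))) })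
      primeDivisors-prime-∣

    primeDivisors-∤⇒gcd≡1 : .{{_ : NonZero n}} → ∀ {x} → All (_∤ x) (primeDivisors n) → gcd x n ≡ 1
    primeDivisors-∤⇒gcd≡1 {x} all-∤ with gcd x n ≟ 1
    ... | yes gcd≡1 = gcd≡1
    ... | no  gcd≢1 = ⊥-elim (no-common-prime (prime-divisor (gcd x n) {{gcd≢0}} gcd≢1))
      where
      gcd≢0 : NonZero (gcd x n)
      gcd≢0 = ≢-nonZero (λ gcd≡0 → ≢-nonZero⁻¹ n (0∣⇒≡0 (subst (_∣ n) gcd≡0 (gcd[m,n]∣n x n))))
      no-common-prime : ¬ (∃[ q ] Prime q × q ∣ gcd x n)
      no-common-prime (q , q-prime , q∣gcd) = All.lookup all-∤
        (∈-primeDivisors q-prime (∣-trans q∣gcd (gcd[m,n]∣n x n))) (∣-trans q∣gcd (gcd[m,n]∣m x n))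

module Count where
  open import Defs using (phiE2; Nk; primeDivisors)
  open import Data.Nat using (ℕ; zero; suc; _+_; _*_; _^_; _∸_; _≤_; _≟_; NonZero)
  open import Data.Nat.Properties using (m+n∸n≡m; m≤n+m; ^-zeroˡ; *-commutativeSemigroup)
  open import Algebra.Properties.CommutativeSemigroup *-commutativeSemigroup using () renaming (interchange to *-interchange)
  open import Data.Nat.Divisibility using (_∣_; _∤_; _∣?_)
  open import Data.Nat.GCD using (gcd)
  open import Data.Nat.Primality using (Prime; prime⇒nonZero; productOfPrimes≢0)
  open import Data.Nat.ListAction using (product)
  open import Data.Nat.ListAction.Properties using (∈⇒∣product)
  open import Data.List using (List; []; _∷_; map)
  open import Data.List.Relation.Unary.All as All using (All; []; _∷_; all?)
  open import Data.List.Relation.Unary.All.Properties using (All¬⇒¬Any)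
  open import Data.List.Relation.Unary.AllPairs using ([]; _∷_)
  open import Data.List.Relation.Unary.Unique.Propositional using (Unique)
  open import Data.Product using (_×_; _,_; proj₁)
  open import Function using (_∘_)
  open import Relation.Nullary using (¬?)
  open import Relation.Binary.PropositionalEquality
  open ≡-Reasoning
  open Congruence
  open BoxSum
  open Indicator
  open Enumeration
  open PrimeDivisors

  𝟙[_∤_] : ℕ → ℕ → ℕ
  𝟙[ p ∤ x ] = 𝟙 (¬? (p ∣? x))

  noneDivide : List ℕ → ℕ → ℕ
  noneDivide ps x = product (map (λ p → 𝟙[ p ∤ x ]) ps)

  𝟙[∤]-resp-mod : ∀ p .{{_ : NonZero p}} {x y} → x ≡ y [mod p ] → 𝟙[ p ∤ x ] ≡ 𝟙[ p ∤ y ]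
  𝟙[∤]-resp-mod p x≡y = 𝟙-cong (¬? (p ∣? _)) (¬? (p ∣? _))
    (λ p∤x p∣y → p∤x (∣-resp-mod p (sym x≡y) p∣y)) (λ p∤y p∣x → p∤y (∣-resp-mod p x≡y p∣x))

  noneDivide-resp-mod : ∀ m .{{_ : NonZero m}} {ps} → All (λ p → Prime p × p ∣ m) ps →
                        ∀ {x y} → x ≡ y [mod m ] → noneDivide ps x ≡ noneDivide ps y
  noneDivide-resp-mod m []                          x≡y = refl
  noneDivide-resp-mod m {p ∷ _} ((p-prime , p∣m) ∷ ps) x≡y = cong₂ _*_
    (𝟙[∤]-resp-mod p {{prime⇒nonZero p-prime}} (≡-mod-divisor {{prime⇒nonZero p-prime}} p∣m x≡y))
    (noneDivide-resp-mod m ps x≡y)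

  𝟙[∤]∘e₂-periodic : ∀ p .{{_ : NonZero p}} {k} → Periodicᵛ {k} p (λ v → 𝟙[ p ∤ e₂ v ])
  𝟙[∤]∘e₂-periodic p u≡v = 𝟙[∤]-resp-mod p (e₂-cong-mod p u≡v)

  noneDivide∘e₂-periodic : ∀ {k ps} (ps-prime : All Prime ps) →
                           Periodicᵛ {k} (product ps) {{productOfPrimes≢0 ps-prime}} (noneDivide ps ∘ e₂)
  noneDivide∘e₂-periodic ps-prime u≡v = noneDivide-resp-mod _ {{productOfPrimes≢0 ps-prime}}
    (All.zip (ps-prime , All.tabulate ∈⇒∣product)) (e₂-cong-mod _ {{productOfPrimes≢0 ps-prime}} u≡v)

  𝟙-coprime≡noneDivide : ∀ n .{{_ : NonZero n}} x → 𝟙 (gcd x n ≟ 1) ≡ noneDivide (primeDivisors n) x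
  𝟙-coprime≡noneDivide n x = trans
    (𝟙-cong (gcd x n ≟ 1) (all? (λ p → ¬? (p ∣? x)) (primeDivisors n)) (gcd≡1⇒primeDivisors-∤ n) (primeDivisors-∤⇒gcd≡1 n))
    (sym (product-𝟙 (λ p → ¬? (p ∣? x)) (primeDivisors n)))

  count-∤+Nk : ∀ k p → ∑ᵛ k p (λ v → 𝟙[ p ∤ e₂ v ]) + Nk k p ≡ p ^ k
  count-∤+Nk k p = begin
    ∑ᵛ k p (λ v → 𝟙[ p ∤ e₂ v ]) + Nk k p                           ≡⟨ cong (∑ᵛ k p (λ v → 𝟙[ p ∤ e₂ v ]) +_)
                                                                         (count-e2 k p (p ∣?_)) ⟩
    ∑ᵛ k p (λ v → 𝟙[ p ∤ e₂ v ]) + ∑ᵛ k p (λ v → 𝟙 (p ∣? e₂ v))    ≡⟨ ∑ᵛ-distrib-+ k p _ _ ⟨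
    ∑ᵛ k p (λ v → 𝟙[ p ∤ e₂ v ] + 𝟙 (p ∣? e₂ v))                   ≡⟨ ∑ᵛ-cong k p (λ v → 𝟙-¬?+𝟙 (p ∣? e₂ v)) ⟩
    ∑ᵛ k p (λ _ → 1)                                                ≡⟨ ∑ᵛ-1 k p ⟩
    p ^ k                                                           ∎

  Nk≤p^k : ∀ k p → Nk k p ≤ p ^ k
  Nk≤p^k k p = subst (Nk k p ≤_) (count-∤+Nk k p) (m≤n+m (Nk k p) _)

  count-noneDivide : ∀ k ps → All Prime ps → Unique ps →
                     ∑ᵛ k (product ps) (noneDivide ps ∘ e₂) ≡ product (map (λ p → p ^ k ∸ Nk k p) ps)
  count-noneDivide k []       []                   []                  = trans (∑ᵛ-1 k 1) (^-zeroˡ k)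
  count-noneDivide k (p ∷ ps) (p-prime ∷ ps-prime) (p∉ps ∷ ps-unique) = begin
    ∑ᵛ k (p * product ps) (λ v → 𝟙[ p ∤ e₂ v ] * noneDivide ps (e₂ v))
      ≡⟨ ∑ᵛ-crt k p (product ps) _ _ p-coprime (𝟙[∤]∘e₂-periodic p) (noneDivide∘e₂-periodic ps-prime) ⟩
    ∑ᵛ k p (λ v → 𝟙[ p ∤ e₂ v ]) * ∑ᵛ k (product ps) (noneDivide ps ∘ e₂)
      ≡⟨ cong₂ _*_ (trans (sym (m+n∸n≡m _ (Nk k p))) (cong (_∸ Nk k p) (count-∤+Nk k p)))
                   (count-noneDivide k ps ps-prime ps-unique) ⟩
    (p ^ k ∸ Nk k p) * product (map (λ p → p ^ k ∸ Nk k p) ps)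
      ∎
    where
    instance
      _ = prime⇒nonZero p-prime
      _ = productOfPrimes≢0 ps-prime
    p-coprime = prime∤⇒coprime p-prime (prime∉⇒∤product p-prime ps-prime (All¬⇒¬Any p∉ps))

  ^-distribʳ-* : ∀ a b k → (a * b) ^ k ≡ a ^ k * b ^ k
  ^-distribʳ-* a b zero    = refl
  ^-distribʳ-* a b (suc k) = trans (cong (a * b *_) (^-distribʳ-* a b k)) (*-interchange a b (a ^ k) (b ^ k))

  product-^ : ∀ ps k → product ps ^ k ≡ product (map (_^ k) ps)
  product-^ []       k = ^-zeroˡ k
  product-^ (p ∷ ps) k = trans (^-distribʳ-* p (product ps) k) (cong (p ^ k *_) (product-^ ps k))

  phiE2≡ : ∀ k n .{{_ : NonZero n}} t → n ≡ t * product (primeDivisors n) →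
           phiE2 k n ≡ t ^ k * product (map (λ p → p ^ k ∸ Nk k p) (primeDivisors n))
  phiE2≡ k n t n≡tM = begin
    phiE2 k n                                     ≡⟨ count-e2 k n (λ x → gcd x n ≟ 1) ⟩
    ∑ᵛ k n (λ v → 𝟙 (gcd (e₂ v) n ≟ 1))           ≡⟨ ∑ᵛ-cong k n (𝟙-coprime≡noneDivide n ∘ e₂) ⟩
    ∑ᵛ k n (noneDivide ps ∘ e₂)                   ≡⟨ cong (λ m → ∑ᵛ k m (noneDivide ps ∘ e₂)) n≡tM ⟩
    ∑ᵛ k (t * product ps) (noneDivide ps ∘ e₂)    ≡⟨ ∑ᵛ-periodic k t _ _ (noneDivide∘e₂-periodic ps-prime) ⟩
    t ^ k * ∑ᵛ k (product ps) (noneDivide ps ∘ e₂)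
      ≡⟨ cong (t ^ k *_) (count-noneDivide k ps ps-prime (primeDivisors-unique n)) ⟩
    t ^ k * product (map (λ p → p ^ k ∸ Nk k p) ps) ∎
    where
    ps = primeDivisors n
    ps-prime = All.map proj₁ (primeDivisors-prime-∣ n)
    instance _ = productOfPrimes≢0 ps-prime

module NatToRational where
  open import Defs using (ratio; prodℚ)
  open import Data.Nat as ℕ using (ℕ; zero; suc; _∸_; _≤_; NonZero)
  import Data.Nat.Properties as ℕ
  open import Data.Nat.ListAction using (product)
  open import Data.Integer as ℤ using (+_)
  import Data.Integer.Properties as ℤ
  open import Data.List using ([]; _∷_; map)
  open import Data.List.Relation.Unary.All using (All; []; _∷_)
  open import Data.Product using (_×_; _,_)
  open import Data.Empty using (⊥-elim)
  open import Data.Rational using (ℚ; 1ℚ; _+_; _*_; _-_; toℚᵘ; fromℚᵘ)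
  open import Data.Rational.Properties
    using (toℚᵘ-injective; toℚᵘ-fromℚᵘ; fromℚᵘ-cong; toℚᵘ-homo-*; toℚᵘ-homo-+; *-assoc; *-identityʳ;
           *-1-commutativeMonoid)
  open import Algebra.Bundles using (CommutativeMonoid)
  open import Algebra.Properties.CommutativeSemigroup (CommutativeMonoid.commutativeSemigroup *-1-commutativeMonoid)
    using () renaming (interchange to *-interchange)
  open import Data.Rational.Unnormalised as ℚᵘ using (ℚᵘ; mkℚᵘ; *≡*)
  import Data.Rational.Unnormalised.Properties as ℚᵘ
  open import Data.Rational.Solver using (module +-*-Solver)
  open import Relation.Binary.PropositionalEquality

  -- ratio a (suc r) unfolds to fromℚᵘ (mkℚᵘ (+ a) r), so identities between such fractions reduce,
  -- through fromℚᵘ-homo-* and fromℚᵘ-homo-+, to cross-multiplication in ℤ.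
  toℚ : ℕ → ℚ
  toℚ a = ratio a 1

  fromℚᵘ-homo-* : ∀ p q → fromℚᵘ (p ℚᵘ.* q) ≡ fromℚᵘ p * fromℚᵘ q
  fromℚᵘ-homo-* p q = toℚᵘ-injective (begin
    toℚᵘ (fromℚᵘ (p ℚᵘ.* q))              ≈⟨ toℚᵘ-fromℚᵘ (p ℚᵘ.* q) ⟩
    p ℚᵘ.* q                               ≈⟨ ℚᵘ.*-cong (toℚᵘ-fromℚᵘ p) (toℚᵘ-fromℚᵘ q) ⟨
    toℚᵘ (fromℚᵘ p) ℚᵘ.* toℚᵘ (fromℚᵘ q)  ≈⟨ toℚᵘ-homo-* (fromℚᵘ p) (fromℚᵘ q) ⟨
    toℚᵘ (fromℚᵘ p * fromℚᵘ q)            ∎)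
    where open ℚᵘ.≃-Reasoning

  fromℚᵘ-homo-+ : ∀ p q → fromℚᵘ (p ℚᵘ.+ q) ≡ fromℚᵘ p + fromℚᵘ q
  fromℚᵘ-homo-+ p q = toℚᵘ-injective (begin
    toℚᵘ (fromℚᵘ (p ℚᵘ.+ q))              ≈⟨ toℚᵘ-fromℚᵘ (p ℚᵘ.+ q) ⟩
    p ℚᵘ.+ q                               ≈⟨ ℚᵘ.+-cong (toℚᵘ-fromℚᵘ p) (toℚᵘ-fromℚᵘ q) ⟨
    toℚᵘ (fromℚᵘ p) ℚᵘ.+ toℚᵘ (fromℚᵘ q)  ≈⟨ toℚᵘ-homo-+ (fromℚᵘ p) (fromℚᵘ q) ⟨
    toℚᵘ (fromℚᵘ p + fromℚᵘ q)            ∎)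
    where open ℚᵘ.≃-Reasoning

  toℚ-homo-* : ∀ a b → toℚ (a ℕ.* b) ≡ toℚ a * toℚ b
  toℚ-homo-* a b = trans (fromℚᵘ-cong {mkℚᵘ (+ (a ℕ.* b)) 0} {mkℚᵘ (+ a) 0 ℚᵘ.* mkℚᵘ (+ b) 0} (*≡* (cong (ℤ._* + 1) (ℤ.pos-* a b))))
                         (fromℚᵘ-homo-* (mkℚᵘ (+ a) 0) (mkℚᵘ (+ b) 0))

  toℚ-homo-+ : ∀ a b → toℚ (a ℕ.+ b) ≡ toℚ a + toℚ b
  toℚ-homo-+ a b = trans (fromℚᵘ-cong {mkℚᵘ (+ (a ℕ.+ b)) 0} {mkℚᵘ (+ a) 0 ℚᵘ.+ mkℚᵘ (+ b) 0} (*≡* (cong (ℤ._* + 1) (begin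
      + (a ℕ.+ b)                   ≡⟨ ℤ.pos-+ a b ⟩
      + a ℤ.+ + b                   ≡⟨ cong₂ ℤ._+_ (ℤ.*-identityʳ (+ a)) (ℤ.*-identityʳ (+ b)) ⟨
      + a ℤ.* + 1 ℤ.+ + b ℤ.* + 1   ∎))))
    (fromℚᵘ-homo-+ (mkℚᵘ (+ a) 0) (mkℚᵘ (+ b) 0))
    where open ≡-Reasoning

  toℚ-homo-∸ : ∀ a b → b ≤ a → toℚ (a ∸ b) ≡ toℚ a - toℚ b
  toℚ-homo-∸ a b b≤a = begin
    toℚ (a ∸ b)                  ≡⟨ solve 2 (λ x y → x := x :+ y :- y) refl (toℚ (a ∸ b)) (toℚ b) ⟩
    toℚ (a ∸ b) + toℚ b - toℚ b  ≡⟨ cong (_- toℚ b) (toℚ-homo-+ (a ∸ b) b) ⟨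
    toℚ (a ∸ b ℕ.+ b) - toℚ b    ≡⟨ cong (λ c → toℚ c - toℚ b) (ℕ.m∸n+n≡m b≤a) ⟩
    toℚ a - toℚ b                ∎
    where
    open ≡-Reasoning
    open +-*-Solver

  toℚ-*-ratio : ∀ a q .{{_ : NonZero q}} → toℚ q * ratio a q ≡ toℚ a
  toℚ-*-ratio a zero    = ⊥-elim (ℕ.≢-nonZero⁻¹ 0 refl)
  toℚ-*-ratio a (suc r) = trans (sym (fromℚᵘ-homo-* (mkℚᵘ (+ suc r) 0) (mkℚᵘ (+ a) r)))
                                (fromℚᵘ-cong {mkℚᵘ (+ suc r) 0 ℚᵘ.* mkℚᵘ (+ a) r} {mkℚᵘ (+ a) 0} (*≡* (begin
    (+ suc r ℤ.* + a) ℤ.* + 1  ≡⟨ ℤ.*-identityʳ _ ⟩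
    + suc r ℤ.* + a            ≡⟨ ℤ.*-comm (+ suc r) (+ a) ⟩
    + a ℤ.* + suc r            ≡⟨ cong (λ d → + a ℤ.* + d) (ℕ.*-identityˡ (suc r)) ⟨
    + a ℤ.* + (1 ℕ.* suc r)    ∎)))
    where open ≡-Reasoning

  toℚ-*-one-minus-ratio : ∀ N q .{{_ : NonZero q}} → N ≤ q → toℚ q * (1ℚ - ratio N q) ≡ toℚ (q ∸ N)
  toℚ-*-one-minus-ratio N q N≤q = begin
    toℚ q * (1ℚ - ratio N q)   ≡⟨ solve 2 (λ x y → x :* (con 1ℚ :- y) := x :- x :* y) refl (toℚ q) (ratio N q) ⟩
    toℚ q - toℚ q * ratio N q  ≡⟨ cong (toℚ q -_) (toℚ-*-ratio N q) ⟩
    toℚ q - toℚ N              ≡⟨ toℚ-homo-∸ q N N≤q ⟨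
    toℚ (q ∸ N)                ∎
    where
    open ≡-Reasoning
    open +-*-Solver

  toℚ-product-*-prodℚ : ∀ (q N : ℕ → ℕ) ps → All (λ p → NonZero (q p) × N p ≤ q p) ps →
    toℚ (product (map q ps)) * prodℚ (map (λ p → 1ℚ - ratio (N p) (q p)) ps) ≡ toℚ (product (map (λ p → q p ∸ N p) ps))
  toℚ-product-*-prodℚ q N []       []                 = *-identityʳ 1ℚ
  toℚ-product-*-prodℚ q N (p ∷ ps) ((q≢0 , N≤q) ∷ hs) = begin
    toℚ (q p ℕ.* Q) * (f p * R)          ≡⟨ cong (_* (f p * R)) (toℚ-homo-* (q p) Q) ⟩
    (toℚ (q p) * toℚ Q) * (f p * R)      ≡⟨ *-interchange (toℚ (q p)) (toℚ Q) (f p) R ⟩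
    (toℚ (q p) * f p) * (toℚ Q * R)      ≡⟨ cong₂ _*_ (toℚ-*-one-minus-ratio (N p) (q p) {{q≢0}} N≤q)
                                                       (toℚ-product-*-prodℚ q N ps hs) ⟩
    toℚ (q p ∸ N p) * toℚ P              ≡⟨ toℚ-homo-* (q p ∸ N p) P ⟨
    toℚ ((q p ∸ N p) ℕ.* P)              ∎
    where
    open ≡-Reasoning
    Q = product (map q ps)
    P = product (map (λ p → q p ∸ N p) ps)
    f : ℕ → ℚ
    f p = 1ℚ - ratio (N p) (q p)
    R = prodℚ (map f ps)

  toℚ-scaled-product-*-prodℚ : ∀ c (q N : ℕ → ℕ) ps → All (λ p → NonZero (q p) × N p ≤ q p) ps →
    toℚ (c ℕ.* product (map q ps)) * prodℚ (map (λ p → 1ℚ - ratio (N p) (q p)) ps) ≡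
    toℚ (c ℕ.* product (map (λ p → q p ∸ N p) ps))
  toℚ-scaled-product-*-prodℚ c q N ps hs = begin
    toℚ (c ℕ.* Q) * R        ≡⟨ cong (_* R) (toℚ-homo-* c Q) ⟩
    toℚ c * toℚ Q * R        ≡⟨ *-assoc (toℚ c) (toℚ Q) R ⟩
    toℚ c * (toℚ Q * R)      ≡⟨ cong (toℚ c *_) (toℚ-product-*-prodℚ q N ps hs) ⟩
    toℚ c * toℚ P            ≡⟨ toℚ-homo-* c P ⟨
    toℚ (c ℕ.* P)            ∎
    where
    open ≡-Reasoning
    Q = product (map q ps)
    P = product (map (λ p → q p ∸ N p) ps)
    R = prodℚ (map (λ p → 1ℚ - ratio (N p) (q p)) ps)

open import Defs
open import Data.Nat using (ℕ; _≤_; _^_)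
open import Data.List using (map)
open import Data.Rational using (ℚ; 1ℚ; _*_; _-_)
open import Relation.Binary.PropositionalEquality using (_≡_)

open import Data.Nat as ℕ using (_∸_; NonZero; >-nonZero)
open import Data.Nat.Properties using (m^n≢0)
open import Data.Nat.Divisibility using (_∣_; divides)
open import Data.Nat.ListAction using (product)
open import Data.Nat.Primality using (prime⇒nonZero)
open import Data.List.Relation.Unary.All as All using (All)
open import Data.Product using (_×_; _,_)
open import Relation.Binary.PropositionalEquality using (cong; trans; module ≡-Reasoning)
open PrimeDivisors using (primeDivisors-prime-∣; product-primeDivisors-∣)
open Count using (phiE2≡; Nk≤p^k; ^-distribʳ-*; product-^)
open NatToRational using (toℚ; toℚ-scaled-product-*-prodℚ)

mainTheorem3 : (k n : ℕ) → 2 ≤ k → 1 ≤ n →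
    ratio (phiE2 k n) 1 ≡
      ratio (n ^ k) 1 * prodℚ (map (λ p → 1ℚ - ratio (Nk k p) (p ^ k)) (primeDivisors n))
mainTheorem3 k n _ 1≤n = from-cofactor (product-primeDivisors-∣ n)
  where
  open ≡-Reasoning
  instance _ = >-nonZero 1≤n
  ps = primeDivisors n
  R = prodℚ (map (λ p → 1ℚ - ratio (Nk k p) (p ^ k)) ps)

  bounds : All (λ p → NonZero (p ^ k) × Nk k p ≤ p ^ k) ps
  bounds = All.map (λ {p} (p-prime , _) → m^n≢0 p k {{prime⇒nonZero p-prime}} , Nk≤p^k k p) (primeDivisors-prime-∣ n)

  from-cofactor : product ps ∣ n → toℚ (phiE2 k n) ≡ toℚ (n ^ k) * R
  from-cofactor (divides t n≡tΠps) = begin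
    toℚ (phiE2 k n)                                          ≡⟨ cong toℚ (phiE2≡ k n t n≡tΠps) ⟩
    toℚ (t ^ k ℕ.* product (map (λ p → p ^ k ∸ Nk k p) ps))  ≡⟨ toℚ-scaled-product-*-prodℚ (t ^ k) (_^ k) (Nk k) ps bounds ⟨
    toℚ (t ^ k ℕ.* product (map (_^ k) ps)) * R              ≡⟨ cong (λ m → toℚ m * R) n^k≡t^kΠp^k ⟨
    toℚ (n ^ k) * R                                          ∎
    where
    n^k≡t^kΠp^k : n ^ k ≡ t ^ k ℕ.* product (map (_^ k) ps)
    n^k≡t^kΠp^k = trans (cong (_^ k) n≡tΠps) (trans (^-distribʳ-* t (product ps) k) (cong (t ^ k ℕ.*_) (product-^ ps k)))
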